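{- Suppose $\epsilon<1/5$. Then for any two vertices $x,y$ in the same almost-clique $C_j$, $|N(x)\cap N(y)|\ge(1-2\epsilon)\Delta$.
   Context: $G=(V,E)$ is a finite simple graph with maximum degree $\Delta$ and $N(v)$ the neighborhood of $v$; $\epsilon\in[0,1]$. An edge $uv$ is a friend edge if $|N(u)\cap N(v)|\ge(1-\epsilon)\Delta$; a vertex is dense if it is incident to at least $(1-\epsilon)\Delta$ friend edges. The almost-cliques $C_1,\dots,C_k$ are the connected components of the graph whose vertex set is the set of dense vertices and whose edges are the friend edges with both endpoints dense. -}

module Defs where

open import Data.Nat using (ℕ; _⊔_)
open import Data.Bool using (Bool; true; false; _∧_)
open import Data.Fin using (Fin)
open import Data.Fin.Subset using (Subset; _∩_; ∣_∣)
open import Data.Vec using (tabulate)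
open import Data.List using (foldr; map; allFin)
open import Data.Product using (_×_)
open import Data.Integer using (+_)
open import Data.Rational using (ℚ; _≤_; _*_; _-_; 1ℚ; _/_)
open import Data.Rational.Properties using (_≤?_)
open import Relation.Nullary using (Dec; yes; no)
open import Relation.Nullary.Decidable using (⌊_⌋)
open import Relation.Binary.PropositionalEquality using (_≡_)

record Graph (n : ℕ) : Set where
  field
    adj    : Fin n → Fin n → Bool
    sym    : ∀ u v → adj u v ≡ adj v u
    irrefl : ∀ v → adj v v ≡ false

data Walk {A : Set} (D : A → Set) (R : A → A → Set) : A → A → Set where
  here : ∀ {x} → D x → Walk D R x x
  step : ∀ {x y z} → D x → R x y → Walk D R y z → Walk D R x z

module _ {n : ℕ} (G : Graph n) where
  open Graph G

  N : Fin n → Subset n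
  N v = tabulate (adj v)

  degree : Fin n → ℕ
  degree v = ∣ N v ∣

  -- maximum degree Δ (0 for the empty graph)
  Δ : ℕ
  Δ = foldr _⊔_ 0 (map degree (allFin n))

  ⟦_⟧ : ℕ → ℚ
  ⟦ k ⟧ = + k / 1

  Friend : ℚ → Fin n → Fin n → Set
  Friend ε u v = (adj u v ≡ true) × ((1ℚ - ε) * ⟦ Δ ⟧ ≤ ⟦ ∣ N u ∩ N v ∣ ⟧)

  friend? : (ε : ℚ) → Fin n → Fin n → Bool
  friend? ε u v = adj u v ∧ ⌊ (1ℚ - ε) * ⟦ Δ ⟧ ≤? ⟦ ∣ N u ∩ N v ∣ ⟧ ⌋

  -- the set of friend edges incident to v, as the set of their other endpoints
  friendsOf : ℚ → Fin n → Subset n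
  friendsOf ε v = tabulate (friend? ε v)

  Dense : ℚ → Fin n → Set
  Dense ε v = (1ℚ - ε) * ⟦ Δ ⟧ ≤ ⟦ ∣ friendsOf ε v ∣ ⟧

  -- x and y lie in the same connected component of the graph whose vertices
  -- are the dense vertices and whose edges are friend edges between dense
  -- vertices, i.e. in the same almost-clique C_j.
  SameAlmostClique : ℚ → Fin n → Fin n → Set
  SameAlmostClique ε = Walk (Dense ε) (Friend ε)

module Submission where

-- Write (1 − kε)Δ for a lower bound with deficit k. For sets P, Q, R the
-- inequality |P ∩ R| ≥ |P ∩ Q| + |Q ∩ R| − |Q| adds deficits whenever |Q| ≤ Δ.
-- Induct along the walk: if xy′ is a friend edge and |N y′ ∩ N y| ≥ (1 − 2ε)Δ,
-- then passing through N x, N y′ and N y, and using the friend sets F x ⊆ N x and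
-- F y ⊆ N y of the dense endpoints, gives |F x ∩ F y| ≥ (1 − 5ε)Δ > 0 (for Δ > 0).
-- So x and y have a common friend i, and through N i we get
-- |N x ∩ N y| ≥ (1 − ε)Δ + (1 − ε)Δ − Δ.

open import Defs
open import Data.Nat using (ℕ)
open import Data.Fin using (Fin)
open import Data.Fin.Subset using (_∩_; ∣_∣)
open import Data.Integer using (+_)
open import Data.Rational using (ℚ; _≤_; _<_; _*_; _-_; 0ℚ; 1ℚ; _/_)

open import Data.Bool.Base using (true)
open import Data.Bool.Properties using (T-≡; T-∧)
open import Data.Nat.Base as ℕ using (suc; z≤n; s≤s; _⊔_)
import Data.Nat.Properties as ℕ
open import Data.Nat.Coprimality using (1-coprimeTo) renaming (sym to coprime-sym)
import Data.Integer.Base as ℤ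
import Data.Integer.Properties as ℤ
open import Data.Rational.Base using (mkℚ; _+_; -_; positive; *≤*; *<*)
open import Data.Rational.Properties
  using ( normalize-coprime; module ≤-Reasoning; ≤-trans; <-irrefl; <-≤-trans
        ; +-mono-≤; +-monoˡ-≤; +-monoʳ-≤; +-monoˡ-<; +-inverseʳ
        ; *-identityˡ; *-zeroˡ; *-zeroʳ; *-monoʳ-<-pos; *-monoˡ-<-pos; _≤?_ )
open import Data.Rational.Solver using (module +-*-Solver)
open import Data.Fin.Subset using (Subset; inside; outside; _∈_; _⊆_; Nonempty)
open import Data.Fin.Subset.Properties
  using (p⊆q⇒∣p∣≤∣q∣; ∣p∣≤∣x∷p∣; x∈p∩q⁺; x∈p∩q⁻; ∩-comm; nonempty?; Empty-unique; ∣⊥∣≡0)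
open import Data.Vec.Base using ([]; _∷_)
open import Data.Vec.Properties using (lookup∘tabulate; []=⇒lookup; lookup⇒[]=)
open import Data.List.Base using (List; _∷_; foldr)
import Data.List.Membership.Propositional as List
open import Data.List.Membership.Propositional.Properties using (∈-map⁺; ∈-allFin)
open import Data.List.Relation.Unary.Any using (here; there)
open import Data.Product.Base using (_,_; proj₁; proj₂)
open import Data.Sum.Base using ([_,_]′)
open import Function.Base using (_$_)
open import Function.Bundles using (Equivalence)
open import Relation.Nullary using (yes; no; contradiction)
open import Relation.Nullary.Decidable using (toWitness)
open import Relation.Binary.PropositionalEquality

∈⇒≤-foldr-⊔ : ∀ {m} {ms : List ℕ} → m List.∈ ms → m ℕ.≤ foldr _⊔_ 0 ms
∈⇒≤-foldr-⊔ (here refl) = ℕ.m≤m⊔n _ _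
∈⇒≤-foldr-⊔ {ms = m′ ∷ _} (there m∈ms) = ℕ.≤-trans (∈⇒≤-foldr-⊔ m∈ms) (ℕ.m≤n⊔m m′ _)

walk-target : ∀ {A : Set} {D : A → Set} {R : A → A → Set} {x y} → Walk D R x y → D y
walk-target (here dy)    = dy
walk-target (step _ _ w) = walk-target w

+-suc-mono-≤ : ∀ {x y z w} → x ℕ.+ y ℕ.≤ z ℕ.+ w → x ℕ.+ suc y ℕ.≤ z ℕ.+ suc w
+-suc-mono-≤ {x} {y} {z} {w} h = subst₂ ℕ._≤_ (sym (ℕ.+-suc x y)) (sym (ℕ.+-suc z w)) (s≤s h)

∣p∩q∣+∣q∩r∣≤∣p∩r∣+∣q∣ : ∀ {n} (p q r : Subset n) → ∣ p ∩ q ∣ ℕ.+ ∣ q ∩ r ∣ ℕ.≤ ∣ p ∩ r ∣ ℕ.+ ∣ q ∣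
∣p∩q∣+∣q∩r∣≤∣p∩r∣+∣q∣ [] [] [] = z≤n
∣p∩q∣+∣q∩r∣≤∣p∩r∣+∣q∣ (inside ∷ p) (outside ∷ q) (c ∷ r) =
  ℕ.≤-trans (∣p∩q∣+∣q∩r∣≤∣p∩r∣+∣q∣ p q r) (ℕ.+-monoˡ-≤ ∣ q ∣ (∣p∣≤∣x∷p∣ c (p ∩ r)))
∣p∩q∣+∣q∩r∣≤∣p∩r∣+∣q∣ (outside ∷ p) (outside ∷ q) (c ∷ r) = ∣p∩q∣+∣q∩r∣≤∣p∩r∣+∣q∣ p q r
∣p∩q∣+∣q∩r∣≤∣p∩r∣+∣q∣ (inside ∷ p) (inside ∷ q) (inside ∷ r) =
  s≤s (+-suc-mono-≤ (∣p∩q∣+∣q∩r∣≤∣p∩r∣+∣q∣ p q r))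
∣p∩q∣+∣q∩r∣≤∣p∩r∣+∣q∣ (inside ∷ p) (inside ∷ q) (outside ∷ r) =
  ℕ.≤-trans (s≤s (∣p∩q∣+∣q∩r∣≤∣p∩r∣+∣q∣ p q r)) (ℕ.≤-reflexive (sym (ℕ.+-suc ∣ p ∩ r ∣ ∣ q ∣)))
∣p∩q∣+∣q∩r∣≤∣p∩r∣+∣q∣ (outside ∷ p) (inside ∷ q) (inside ∷ r) =
  +-suc-mono-≤ (∣p∩q∣+∣q∩r∣≤∣p∩r∣+∣q∣ p q r)
∣p∩q∣+∣q∩r∣≤∣p∩r∣+∣q∣ (outside ∷ p) (inside ∷ q) (outside ∷ r) =
  ℕ.≤-trans (∣p∩q∣+∣q∩r∣≤∣p∩r∣+∣q∣ p q r) (ℕ.+-monoʳ-≤ ∣ p ∩ r ∣ (ℕ.n≤1+n ∣ q ∣))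

p⊆q⇒∣p∣≤∣p∩q∣ : ∀ {n} {p q : Subset n} → p ⊆ q → ∣ p ∣ ℕ.≤ ∣ p ∩ q ∣
p⊆q⇒∣p∣≤∣p∩q∣ p⊆q = p⊆q⇒∣p∣≤∣q∣ (λ x∈p → x∈p∩q⁺ (x∈p , p⊆q x∈p))

p⊆p′⇒p∩q⊆p′∩q : ∀ {n} {p p′ q : Subset n} → p ⊆ p′ → p ∩ q ⊆ p′ ∩ q
p⊆p′⇒p∩q⊆p′∩q {p = p} {q = q} p⊆p′ x∈p∩q with x∈p∩q⁻ p q x∈p∩q
... | x∈p , x∈q = x∈p∩q⁺ (p⊆p′ x∈p , x∈q)

∣p∣>0⇒nonempty : ∀ {n} (p : Subset n) → 0 ℕ.< ∣ p ∣ → Nonempty p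
∣p∣>0⇒nonempty {n} p ∣p∣>0 with nonempty? p
... | yes ne  = ne
... | no ¬ne = contradiction (trans (cong ∣_∣ (Empty-unique ¬ne)) (∣⊥∣≡0 n)) (ℕ.>⇒≢ ∣p∣>0)

fromℕ : ℕ → ℚ
fromℕ k = + k / 1

fromℕ≡mkℚ : ∀ k → fromℕ k ≡ mkℚ (+ k) 0 (coprime-sym (1-coprimeTo k))
fromℕ≡mkℚ k = normalize-coprime (coprime-sym (1-coprimeTo k))

fromℕ-homo-+ : ∀ m n → fromℕ (m ℕ.+ n) ≡ fromℕ m + fromℕ n
fromℕ-homo-+ m n rewrite fromℕ≡mkℚ m | fromℕ≡mkℚ n | ℤ.*-identityʳ (+ m) | ℤ.*-identityʳ (+ n) =
  cong (_/ 1) (ℤ.pos-+ m n)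

fromℕ-mono-≤ : ∀ {m n} → m ℕ.≤ n → fromℕ m ≤ fromℕ n
fromℕ-mono-≤ {m} {n} m≤n rewrite fromℕ≡mkℚ m | fromℕ≡mkℚ n =
  *≤* (subst₂ ℤ._≤_ (sym (ℤ.*-identityʳ (+ m))) (sym (ℤ.*-identityʳ (+ n))) (ℤ.+≤+ m≤n))

fromℕ-mono-< : ∀ {m n} → m ℕ.< n → fromℕ m < fromℕ n
fromℕ-mono-< {m} {n} m<n rewrite fromℕ≡mkℚ m | fromℕ≡mkℚ n =
  *<* (subst₂ ℤ._<_ (sym (ℤ.*-identityʳ (+ m))) (sym (ℤ.*-identityʳ (+ n))) (ℤ.+<+ m<n))

fromℕ-cancel-< : ∀ {m n} → fromℕ m < fromℕ n → m ℕ.< n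
fromℕ-cancel-< m<n = ℕ.≰⇒> (λ n≤m → <-irrefl refl (<-≤-trans m<n (fromℕ-mono-≤ n≤m)))

p<1⇒0<1-p : ∀ {p} → p < 1ℚ → 0ℚ < 1ℚ - p
p<1⇒0<1-p {p} p<1 = subst (_< 1ℚ - p) (+-inverseʳ p) (+-monoˡ-< (- p) p<1)

module Deficit (ε D : ℚ) where

  threshold : ℕ → ℚ
  threshold k = (1ℚ - fromℕ k * ε) * D

  threshold-+ : ∀ j k → threshold j + threshold k - D ≡ threshold (j ℕ.+ k)
  threshold-+ j k rewrite fromℕ-homo-+ j k =
    solve 4 (λ a b e d → (con 1ℚ :- a :* e) :* d :+ (con 1ℚ :- b :* e) :* d :- d
                         := (con 1ℚ :- (a :+ b) :* e) :* d)
          refl (fromℕ j) (fromℕ k) ε D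
    where open +-*-Solver

  threshold-1 : threshold 1 ≡ (1ℚ - ε) * D
  threshold-1 = cong (λ t → (1ℚ - t) * D) (*-identityˡ ε)

  threshold-pos : ∀ {k} → fromℕ k * ε < 1ℚ → 0ℚ < D → 0ℚ < threshold k
  threshold-pos {k} kε<1 0<D =
    subst (_< threshold k) (*-zeroˡ D) (*-monoˡ-<-pos D {{positive 0<D}} (p<1⇒0<1-p kε<1))

  -- A record rather than a bare inequality: fromℕ is not injective, so the
  -- sets would otherwise not be inferable from an Overlap hypothesis.
  record Overlap {n} (k : ℕ) (p q : Subset n) : Set where
    constructor mkOverlap
    field lower-bound : threshold k ≤ fromℕ ∣ p ∩ q ∣

  D≡0⇒Overlap : D ≡ 0ℚ → ∀ {n k} {p q : Subset n} → Overlap k p q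
  D≡0⇒Overlap refl {k = k} {p} {q} = mkOverlap $
    subst (_≤ fromℕ ∣ p ∩ q ∣) (sym (*-zeroʳ (1ℚ - fromℕ k * ε))) (fromℕ-mono-≤ {0} {∣ p ∩ q ∣} z≤n)

  overlap-sym : ∀ {n k} {p q : Subset n} → Overlap k p q → Overlap k q p
  overlap-sym {k = k} {p} {q} (mkOverlap pq) =
    mkOverlap (subst (λ s → threshold k ≤ fromℕ ∣ s ∣) (∩-comm p q) pq)

  overlap-monoˡ : ∀ {n k} {p p′ q : Subset n} → p ⊆ p′ → Overlap k p q → Overlap k p′ q
  overlap-monoˡ {p = p} {p′} {q} p⊆p′ (mkOverlap pq) =
    mkOverlap (≤-trans pq (fromℕ-mono-≤ {∣ p ∩ q ∣} {∣ p′ ∩ q ∣} (p⊆q⇒∣p∣≤∣q∣ (p⊆p′⇒p∩q⊆p′∩q p⊆p′))))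

  overlap-trans : ∀ {n j k} {p q r : Subset n} → fromℕ ∣ q ∣ ≤ D →
                  Overlap j p q → Overlap k q r → Overlap (j ℕ.+ k) p r
  overlap-trans {j = j} {k} {p} {q} {r} q≤D (mkOverlap pq) (mkOverlap qr) = mkOverlap $ begin
    threshold (j ℕ.+ k)                        ≡⟨ threshold-+ j k ⟨
    threshold j + threshold k - D              ≤⟨ +-monoˡ-≤ (- D) (+-mono-≤ pq qr) ⟩
    (fromℕ ∣ p ∩ q ∣) + (fromℕ ∣ q ∩ r ∣) - D  ≡⟨ cong (_- D) (fromℕ-homo-+ ∣ p ∩ q ∣ ∣ q ∩ r ∣) ⟨
    fromℕ (∣ p ∩ q ∣ ℕ.+ ∣ q ∩ r ∣) - D        ≤⟨ +-monoˡ-≤ (- D) (fromℕ-mono-≤ (∣p∩q∣+∣q∩r∣≤∣p∩r∣+∣q∣ p q r)) ⟩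
    fromℕ (∣ p ∩ r ∣ ℕ.+ ∣ q ∣) - D            ≡⟨ cong (_- D) (fromℕ-homo-+ ∣ p ∩ r ∣ ∣ q ∣) ⟩
    (fromℕ ∣ p ∩ r ∣) + (fromℕ ∣ q ∣) - D      ≤⟨ +-monoˡ-≤ (- D) (+-monoʳ-≤ (fromℕ ∣ p ∩ r ∣) q≤D) ⟩
    (fromℕ ∣ p ∩ r ∣) + D - D                  ≡⟨ solve 2 (λ x d → x :+ d :- d := x) refl (fromℕ ∣ p ∩ r ∣) D ⟩
    fromℕ ∣ p ∩ r ∣                            ∎
    where open ≤-Reasoning
          open +-*-Solver

  overlap⇒nonempty : ∀ {n k} {p q : Subset n} → fromℕ k * ε < 1ℚ → 0ℚ < D →
                     Overlap k p q → Nonempty (p ∩ q)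
  overlap⇒nonempty {k = k} {p} {q} kε<1 0<D (mkOverlap pq) =
    ∣p∣>0⇒nonempty (p ∩ q) (fromℕ-cancel-< {0} {∣ p ∩ q ∣} (<-≤-trans (threshold-pos {k} kε<1 0<D) pq))

module _ {n : ℕ} (G : Graph n) (ε : ℚ) where
  open Graph G using (adj)
  open Deficit ε (fromℕ (Δ G))

  private
    F : Fin n → Subset n
    F = friendsOf G ε

  degree≤Δ : ∀ v → degree G v ℕ.≤ Δ G
  degree≤Δ v = ∈⇒≤-foldr-⊔ (∈-map⁺ (degree G) (∈-allFin v))

  friend?⇒Friend : ∀ {u v} → friend? G ε u v ≡ true → Friend G ε u v
  friend?⇒Friend {u} {v} eq =
    Equivalence.to T-≡ (proj₁ adj×bound) ,
    toWitness {a? = (1ℚ - ε) * ⟦_⟧ G (Δ G) ≤? ⟦_⟧ G ∣ N G u ∩ N G v ∣} (proj₂ adj×bound)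
    where adj×bound = Equivalence.to T-∧ (Equivalence.from T-≡ eq)

  ∈-friendsOf⁻ : ∀ {v i} → i ∈ F v → Friend G ε v i
  ∈-friendsOf⁻ {v} {i} i∈Fv =
    friend?⇒Friend (trans (sym (lookup∘tabulate (friend? G ε v) i)) ([]=⇒lookup i∈Fv))

  friendsOf⊆N : ∀ {v} → F v ⊆ N G v
  friendsOf⊆N {v} {i} i∈Fv =
    lookup⇒[]= i (N G v) (trans (lookup∘tabulate (adj v) i) (proj₁ (∈-friendsOf⁻ i∈Fv)))

  Friend⇒Overlap : ∀ {u v} → Friend G ε u v → Overlap 1 (N G u) (N G v)
  Friend⇒Overlap {u} {v} (_ , bound) =
    mkOverlap (subst (_≤ fromℕ ∣ N G u ∩ N G v ∣) (sym threshold-1) bound)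

  Dense⇒Overlap : ∀ {v} → Dense G ε v → Overlap 1 (F v) (N G v)
  Dense⇒Overlap {v} dense = mkOverlap $ subst (_≤ fromℕ ∣ F v ∩ N G v ∣) (sym threshold-1) $
    ≤-trans dense (fromℕ-mono-≤ (p⊆q⇒∣p∣≤∣p∩q∣ (friendsOf⊆N {v})))

  overlap-via-N : ∀ {j k} {p r : Subset n} v →
                  Overlap j p (N G v) → Overlap k (N G v) r → Overlap (j ℕ.+ k) p r
  overlap-via-N v = overlap-trans {q = N G v} (fromℕ-mono-≤ (degree≤Δ v))

  Dense⇒self-Overlap : ∀ {x} → Dense G ε x → Overlap 2 (N G x) (N G x)
  Dense⇒self-Overlap {x} dense = overlap-via-N x Nx-overlap Nx-overlap
    where
    Nx-overlap : Overlap 1 (N G x) (N G x)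
    Nx-overlap = overlap-monoˡ (friendsOf⊆N {x}) (Dense⇒Overlap dense)

  common-friend⇒Overlap : ∀ {x y i} → i ∈ F x ∩ F y → Overlap 2 (N G x) (N G y)
  common-friend⇒Overlap {x} {y} {i} i∈Fx∩Fy =
    overlap-via-N i (Friend⇒Overlap (∈-friendsOf⁻ (proj₁ i∈Fx×i∈Fy)))
                    (overlap-sym (Friend⇒Overlap (∈-friendsOf⁻ (proj₂ i∈Fx×i∈Fy))))
    where i∈Fx×i∈Fy = x∈p∩q⁻ (F x) (F y) i∈Fx∩Fy

  friendsOf-Overlap : ∀ {x y′ y} → Dense G ε x → Dense G ε y → Friend G ε x y′ →
                      Overlap 2 (N G y′) (N G y) → Overlap 5 (F x) (F y)
  friendsOf-Overlap {x} {y′} {y} dx dy xy′ y′y =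
    overlap-via-N y (overlap-via-N x (Dense⇒Overlap dx) (overlap-via-N y′ (Friend⇒Overlap xy′) y′y))
                    (overlap-sym (Dense⇒Overlap dy))

  -- The case split on Δ is done with [_,_]′ rather than 'with': abstracting
  -- over it makes type checking blow up.
  Overlap-extend : ∀ {x y′ y} → fromℕ 5 * ε < 1ℚ → Dense G ε x → Dense G ε y → Friend G ε x y′ →
                   Overlap 2 (N G y′) (N G y) → Overlap 2 (N G x) (N G y)
  Overlap-extend {x} {y′} {y} 5ε<1 dx dy xy′ y′y =
    [ via-common-friend , Δ≡0 ]′ (ℕ.m≤n⇒m<n∨m≡n (z≤n {Δ G}))
    where
    via-common-friend : 0 ℕ.< Δ G → Overlap 2 (N G x) (N G y)
    via-common-friend 0<Δ = common-friend⇒Overlap {x} {y} (proj₂ common-friend)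
      where
      common-friend : Nonempty (F x ∩ F y)
      common-friend = overlap⇒nonempty 5ε<1 (fromℕ-mono-< {0} {Δ G} 0<Δ) (friendsOf-Overlap dx dy xy′ y′y)

    Δ≡0 : 0 ≡ Δ G → Overlap 2 (N G x) (N G y)
    Δ≡0 0≡Δ = D≡0⇒Overlap (cong fromℕ (sym 0≡Δ))

  sameAlmostClique⇒Overlap : ∀ {x y} → fromℕ 5 * ε < 1ℚ → SameAlmostClique G ε x y →
                             Overlap 2 (N G x) (N G y)
  sameAlmostClique⇒Overlap 5ε<1 (here dx)       = Dense⇒self-Overlap dx
  sameAlmostClique⇒Overlap 5ε<1 (step dx xy′ w) =
    Overlap-extend 5ε<1 dx (walk-target w) xy′ (sameAlmostClique⇒Overlap 5ε<1 w)

mainTheorem6 : {n : ℕ} (G : Graph n) (ε : ℚ) → 0ℚ ≤ ε → ε ≤ 1ℚ → ε < + 1 / 5 →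
               ∀ x y → SameAlmostClique G ε x y →
               (1ℚ - (+ 2 / 1) * ε) * ⟦_⟧ G (Δ G) ≤ ⟦_⟧ G ∣ N G x ∩ N G y ∣
mainTheorem6 G ε _ _ ε<1/5 x y w =
  Deficit.Overlap.lower-bound (sameAlmostClique⇒Overlap G ε 5ε<1 w)
  where
  5ε<1 : fromℕ 5 * ε < 1ℚ
  5ε<1 = *-monoʳ-<-pos (fromℕ 5) ε<1/5
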